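{- Let $K$ be an imaginary quadratic field with ring of integers $\mathcal{O}$ and let $\mathfrak{P}$ be a prime ideal of $\mathcal{O}$. Then $\Gamma_0(\mathfrak{P})\not\subset\Gamma(u,v)$ for every nonzero $(u,v)\in(\mathbb{C}/K)^2$.
   Context: $\Gamma_0(\mathfrak{P})=\{\begin{pmatrix}a&b\\c&d\end{pmatrix}\in\mathrm{SL}_2(\mathcal{O}):c\in\mathfrak{P}\}$, and for $(u,v)\in(\mathbb{C}/K)^2$, $\Gamma(u,v)=\{A\in\mathrm{SL}_2(\mathcal{O}):(u,v)A=(u,v)\}$, where $(u,v)A$ is the row vector times matrix product. -}

module Defs where

open import Level using (Level; _⊔_; suc; 0ℓ)
open import Data.Nat as ℕ using (ℕ)
open import Data.Nat.Divisibility using (_∣_)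
open import Data.Integer as ℤ using (ℤ)
open import Data.Rational as ℚ using (ℚ; 0ℚ; 1ℚ)
open import Data.List using (List; []; _∷_)
open import Data.Product using (Σ; _×_; ∃; _,_; proj₁; proj₂)
open import Data.Sum using (_⊎_)
open import Relation.Nullary using (¬_)
open import Relation.Binary.PropositionalEquality using (_≡_)
open import Algebra.Bundles using (CommutativeRing)
open import Algebra.Bundles.Raw using (RawRing)
open import Algebra.Morphism.Structures using (IsRingHomomorphism)

-- d is squarefree (this also forces d ≠ 0, since 2*2 ∣ 0).
SquareFree : ℕ → Set
SquareFree d = ∀ p → p ℕ.* p ∣ d → p ≡ 1

-- The imaginary quadratic field K = ℚ(√-d), d ≥ 1 squarefree.
-- An element  re + im·√-d  is stored as the pair (re , im).
record Quad : Set where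
  constructor ⟨_,_⟩
  field
    re : ℚ
    im : ℚ

module QuadField (d : ℕ) where

  dℚ : ℚ
  dℚ = ℤ.+ d ℚ./ 1

  K : Set
  K = Quad

  _+K_ : K → K → K
  ⟨ a , b ⟩ +K ⟨ c , e ⟩ = ⟨ a ℚ.+ c , b ℚ.+ e ⟩

  _*K_ : K → K → K
  ⟨ a , b ⟩ *K ⟨ c , e ⟩ = ⟨ a ℚ.* c ℚ.- dℚ ℚ.* (b ℚ.* e) , a ℚ.* e ℚ.+ b ℚ.* c ⟩

  -K_ : K → K
  -K ⟨ a , b ⟩ = ⟨ ℚ.- a , ℚ.- b ⟩

  0K : K
  0K = ⟨ 0ℚ , 0ℚ ⟩

  1K : K
  1K = ⟨ 1ℚ , 0ℚ ⟩

  _-K_ : K → K → K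
  x -K y = x +K (-K y)

  ιℤ : ℤ → K
  ιℤ z = ⟨ z ℚ./ 1 , 0ℚ ⟩

  rawRingK : RawRing 0ℓ 0ℓ
  rawRingK = record
    { Carrier = K ; _≈_ = _≡_ ; _+_ = _+K_ ; _*_ = _*K_
    ; -_ = -K_ ; 0# = 0K ; 1# = 1K }

  -- Evaluation of the monic polynomial
  --   x^n + c_{n-1} x^{n-1} + ... + c_0,  coefficients listed [c_{n-1}, ..., c_0],
  -- by Horner's scheme starting from the leading coefficient 1.
  horner : K → K → List ℤ → K
  horner x acc []       = acc
  horner x acc (c ∷ cs) = horner x ((acc *K x) +K ιℤ c) cs

  evalMonic : List ℤ → K → K
  evalMonic cs x = horner x 1K cs

  Int𝒪 : K → Set
  Int𝒪 x = Σ (List ℤ) λ cs → evalMonic cs x ≡ 0K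

  record IsPrimeIdeal {ℓ : Level} (P : K → Set ℓ) : Set ℓ where
    field
      ⊆𝒪     : ∀ {x} → P x → Int𝒪 x
      zero∈  : P 0K
      +-closed : ∀ {x y} → P x → P y → P (x +K y)
      *-closed : ∀ {r x} → Int𝒪 r → P x → P (r *K x)
      proper : ¬ P 1K
      prime  : ∀ {x y} → Int𝒪 x → Int𝒪 y → P (x *K y) → P x ⊎ P y

  -- 2×2 matrices (a b ; c e) over K
  record M2 : Set where
    constructor mat
    field
      a b c e : K

  InSL2𝒪 : M2 → Set
  InSL2𝒪 (mat a b c e) =
    Int𝒪 a × Int𝒪 b × Int𝒪 c × Int𝒪 e × ((a *K e) -K (b *K c)) ≡ 1K

  InΓ₀ : {ℓ : Level} → (K → Set ℓ) → M2 → Set ℓ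
  InΓ₀ P A = InSL2𝒪 A × P (M2.c A)

  IsField : {c ℓ : Level} → CommutativeRing c ℓ → Set (c ⊔ ℓ)
  IsField L = ¬ (1# ≈ 0#) × (∀ x → ¬ (x ≈ 0#) → ∃ λ y → x * y ≈ 1#)
    where open CommutativeRing L

  -- A field L together with an embedding (ring homomorphism) φ : K → L.
  -- L/K is the additive quotient, represented via the equivalence ≈mod.
  module Ext {c ℓ : Level} (L : CommutativeRing c ℓ) (φ : K → CommutativeRing.Carrier L) where
    open CommutativeRing L

    _≈modK_ : Carrier → Carrier → Set ℓ
    x ≈modK y = ∃ λ k → (x - y) ≈ φ k

    act : Carrier × Carrier → M2 → Carrier × Carrier
    act (u , v) (mat a b c' e) = (u * φ a + v * φ c' , u * φ b + v * φ e)

    InΓuv : Carrier → Carrier → M2 → Set ℓ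
    InΓuv u v A = (proj₁ (act (u , v) A) ≈modK u) × (proj₂ (act (u , v) A) ≈modK v)

    NonzeroModK : Carrier → Carrier → Set ℓ
    NonzeroModK u v = ¬ ((u ≈modK 0#) × (v ≈modK 0#))

-- The matrices T = (1 1 ; 0 1) and −I lie in Γ₀(𝔓) for every ideal 𝔓.
-- If both fix (u,v) modulo K, then T gives (u , u + v) ≡ (u , v), so u ∈ K,
-- and −I gives −v ≡ v, so 2v ∈ K and hence v ∈ K: (u,v) is zero in (ℂ/K)².
module Submission where

open import Defs
open import Level using (Level)
open import Data.Nat using (ℕ)
open import Data.Integer as ℤ using ()
open import Data.Rational as ℚ using (0ℚ; 1ℚ)
import Data.Rational.Properties as ℚP
open import Data.List using ([]; _∷_)
open import Data.Product using (_,_; proj₂)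
open import Relation.Nullary using (¬_)
open import Relation.Binary.PropositionalEquality as ≡ using (_≡_; refl; cong; cong₂)
open import Algebra.Bundles using (CommutativeRing)
open import Algebra.Morphism.Structures using (IsRingHomomorphism)
import Algebra.Properties.Ring as RingProperties
import Relation.Binary.Reasoning.Setoid as SetoidReasoning

-- ℚ._/_ sends -[1+ n ] to the negation of the image of +[1+ n ], so both
-- nonzero cases are the additive inverse law.
/1-inverseʳ : ∀ z → (z ℚ./ 1) ℚ.+ (ℤ.- z ℚ./ 1) ≡ 0ℚ
/1-inverseʳ (ℤ.+ 0)      = refl
/1-inverseʳ ℤ.+[1+ n ]   = ℚP.+-inverseʳ (ℤ.+[1+ n ] ℚ./ 1)
/1-inverseʳ ℤ.-[1+ n ]   = ℚP.+-inverseˡ (ℤ.+[1+ n ] ℚ./ 1)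

module QuadFieldFacts (d : ℕ) where
  open QuadField d

  rational-* : ∀ p q → ⟨ p , 0ℚ ⟩ *K ⟨ q , 0ℚ ⟩ ≡ ⟨ p ℚ.* q , 0ℚ ⟩
  rational-* p q
    rewrite ℚP.*-zeroʳ dℚ | ℚP.*-zeroʳ p | ℚP.*-zeroˡ q | ℚP.+-identityʳ (p ℚ.* q) = refl

  -- ιℤ z is a root of X − z.
  ιℤ-integral : ∀ z → Int𝒪 (ιℤ z)
  ιℤ-integral z = ℤ.- z ∷ [] , (begin
    (1K *K ιℤ z) +K ιℤ (ℤ.- z)  ≡⟨ cong (_+K ιℤ (ℤ.- z)) (rational-* 1ℚ (z ℚ./ 1)) ⟩
    ⟨ 1ℚ ℚ.* (z ℚ./ 1) ℚ.+ (ℤ.- z ℚ./ 1) , 0ℚ ⟩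
        ≡⟨ cong (λ p → ⟨ p ℚ.+ (ℤ.- z ℚ./ 1) , 0ℚ ⟩) (ℚP.*-identityˡ (z ℚ./ 1)) ⟩
    ⟨ (z ℚ./ 1) ℚ.+ (ℤ.- z ℚ./ 1) , 0ℚ ⟩  ≡⟨ cong ⟨_, 0ℚ ⟩ (/1-inverseʳ z) ⟩
    0K                           ∎)
    where open ≡.≡-Reasoning

  translation : M2
  translation = mat 1K 1K 0K 1K

  negI : M2
  negI = mat (-K 1K) 0K 0K (-K 1K)

  -2K : K
  -2K = (-K 1K) +K (-K 1K)

  -2K⁻¹ : K
  -2K⁻¹ = ⟨ ℤ.- ℤ.+ 1 ℚ./ 2 , 0ℚ ⟩

  -2K*-2K⁻¹ : -2K *K -2K⁻¹ ≡ 1K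
  -2K*-2K⁻¹ = rational-* (ℚ.- 1ℚ ℚ.+ ℚ.- 1ℚ) (ℤ.- ℤ.+ 1 ℚ./ 2)

  module _ {ℓP : Level} {P : K → Set ℓP} (P-ideal : IsPrimeIdeal P) where
    open IsPrimeIdeal P-ideal using (zero∈)

    translation∈Γ₀ : InΓ₀ P translation
    translation∈Γ₀ =
      ( ιℤ-integral (ℤ.+ 1) , ιℤ-integral (ℤ.+ 1) , ιℤ-integral (ℤ.+ 0) , ιℤ-integral (ℤ.+ 1)
      , cong₂ _-K_ (rational-* 1ℚ 1ℚ) (rational-* 1ℚ 0ℚ) )
      , zero∈

    negI∈Γ₀ : InΓ₀ P negI
    negI∈Γ₀ =
      ( ιℤ-integral (ℤ.- ℤ.+ 1) , ιℤ-integral (ℤ.+ 0) , ιℤ-integral (ℤ.+ 0) , ιℤ-integral (ℤ.- ℤ.+ 1)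
      , cong₂ _-K_ (rational-* (ℚ.- 1ℚ) (ℚ.- 1ℚ)) (rational-* 0ℚ 0ℚ) )
      , zero∈

  module ModK {c ℓ : Level} (L : CommutativeRing c ℓ) (φ : K → CommutativeRing.Carrier L)
           (φ-hom : IsRingHomomorphism rawRingK (CommutativeRing.rawRing L) φ) where
    open CommutativeRing L
    open RingProperties ring using (-0#≈0#; -‿distribʳ-*)
    open SetoidReasoning setoid
    open Ext L φ
    module φ = IsRingHomomorphism φ-hom

    x-0≈x : ∀ x → x - 0# ≈ x
    x-0≈x x = trans (+-congˡ -0#≈0#) (+-identityʳ x)

    ≈modK-respˡ : ∀ {x y z} → x ≈ y → x ≈modK z → y ≈modK z
    ≈modK-respˡ x≈y (k , x-z≈k) = k , trans (+-congʳ (sym x≈y)) x-z≈k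

    +≈modK⇒≈modK0 : ∀ {x y} → (x + y) ≈modK y → x ≈modK 0#
    +≈modK⇒≈modK0 {x} {y} (k , eq) = k , (begin
      x - 0#        ≈⟨ x-0≈x x ⟩
      x             ≈⟨ sym (+-identityʳ x) ⟩
      x + 0#        ≈⟨ +-congˡ (sym (-‿inverseʳ y)) ⟩
      x + (y - y)   ≈⟨ sym (+-assoc x y (- y)) ⟩
      (x + y) - y   ≈⟨ eq ⟩
      φ k           ∎)

    *φ-unit≈modK0 : ∀ t s {x} → t *K s ≡ 1K → (x * φ t) ≈modK 0# → x ≈modK 0#
    *φ-unit≈modK0 t s {x} ts≡1 (k , eq) = k *K s , (begin
      x - 0#              ≈⟨ x-0≈x x ⟩
      x                   ≈⟨ sym (*-identityʳ x) ⟩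
      x * 1#              ≈⟨ *-congˡ (sym φ.1#-homo) ⟩
      x * φ 1K            ≈⟨ *-congˡ (reflexive (cong φ (≡.sym ts≡1))) ⟩
      x * φ (t *K s)      ≈⟨ *-congˡ (φ.*-homo t s) ⟩
      x * (φ t * φ s)     ≈⟨ sym (*-assoc x (φ t) (φ s)) ⟩
      (x * φ t) * φ s     ≈⟨ *-congʳ (trans (sym (x-0≈x (x * φ t))) eq) ⟩
      φ k * φ s           ≈⟨ sym (φ.*-homo k s) ⟩
      φ (k *K s)          ∎)

    *φ-1K≈- : ∀ x → x * φ (-K 1K) ≈ - x
    *φ-1K≈- x = begin
      x * φ (-K 1K)  ≈⟨ *-congˡ (trans (φ.-‿homo 1K) (-‿cong φ.1#-homo)) ⟩
      x * - 1#       ≈⟨ sym (-‿distribʳ-* x 1#) ⟩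
      - (x * 1#)     ≈⟨ -‿cong (*-identityʳ x) ⟩
      - x            ∎

    neg≈modK⇒≈modK0 : ∀ {x} → (- x) ≈modK x → x ≈modK 0#
    neg≈modK⇒≈modK0 {x} (k , eq) = *φ-unit≈modK0 -2K -2K⁻¹ -2K*-2K⁻¹ (k , (begin
      x * φ -2K - 0#                      ≈⟨ x-0≈x (x * φ -2K) ⟩
      x * φ -2K                           ≈⟨ *-congˡ (φ.+-homo (-K 1K) (-K 1K)) ⟩
      x * (φ (-K 1K) + φ (-K 1K))         ≈⟨ distribˡ x (φ (-K 1K)) (φ (-K 1K)) ⟩
      x * φ (-K 1K) + x * φ (-K 1K)       ≈⟨ +-cong (*φ-1K≈- x) (*φ-1K≈- x) ⟩
      - x - x                             ≈⟨ eq ⟩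
      φ k                                 ∎))

    act-translation₂ : ∀ u v → u * φ 1K + v * φ 1K ≈ u + v
    act-translation₂ u v =
      +-cong (trans (*-congˡ φ.1#-homo) (*-identityʳ u)) (trans (*-congˡ φ.1#-homo) (*-identityʳ v))

    act-negI₂ : ∀ u v → u * φ 0K + v * φ (-K 1K) ≈ - v
    act-negI₂ u v = begin
      u * φ 0K + v * φ (-K 1K)  ≈⟨ +-congʳ (trans (*-congˡ φ.0#-homo) (zeroʳ u)) ⟩
      0# + v * φ (-K 1K)        ≈⟨ +-identityˡ _ ⟩
      v * φ (-K 1K)             ≈⟨ *φ-1K≈- v ⟩
      - v                       ∎

lemma12 : (d : ℕ) → SquareFree d →
          {ℓP : Level} (P : Quad → Set ℓP) → QuadField.IsPrimeIdeal d P →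
          {c ℓ : Level} (L : CommutativeRing c ℓ) → QuadField.IsField d L →
          (φ : Quad → CommutativeRing.Carrier L) →
          IsRingHomomorphism (QuadField.rawRingK d) (CommutativeRing.rawRing L) φ →
          (u v : CommutativeRing.Carrier L) →
          QuadField.Ext.NonzeroModK d L φ u v →
          ¬ (∀ A → QuadField.InΓ₀ d P A → QuadField.Ext.InΓuv d L φ u v A)
lemma12 d _ P P-ideal L _ φ φ-hom u v nonzero Γ₀⊆Γuv = nonzero (u≈modK0 , v≈modK0)
  where
  open QuadFieldFacts d
  open ModK L φ φ-hom
  u≈modK0 = +≈modK⇒≈modK0 (≈modK-respˡ (act-translation₂ u v)
              (proj₂ (Γ₀⊆Γuv translation (translation∈Γ₀ P-ideal))))
  v≈modK0 = neg≈modK⇒≈modK0 (≈modK-respˡ (act-negI₂ u v)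
              (proj₂ (Γ₀⊆Γuv negI (negI∈Γ₀ P-ideal))))
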